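{- The rule $(\Box^+_{Tn})$ is height-preserving invertible in $\mathsf{G}(\mathbf{KT_n^+})$: if $\Sigma|\Gamma,\Box_iA\Rightarrow\Delta$ has a derivation of height at most $n$, then $\Box_iA,\Sigma|\Gamma,A\Rightarrow\Delta$ has a derivation of height at most $n$.
   Context: Formulas of $\mathcal{L}^1$ over a finite agent set and countable $\mathsf{Prop}$: $A::=p\mid\bot\mid A\wedge A\mid A\vee A\mid A\rightarrow A\mid\neg A\mid\Box_i A$. Outmost-boxed formula: $\Box_jB$; $\Box_i\Gamma=\{\Box_iA:A\in\Gamma\}$. A T-sequent $\Sigma|\Gamma\Rightarrow\Delta$ consists of finite multisets with $\Sigma$ consisting of outmost-boxed formulas. A derivation is a finite tree generated by the rules from initial T-sequents; its height is the maximum length of a branch from the root to an initial T-sequent. $\mathsf{G}(\mathbf{KT_n^+})$: initial T-sequents $\Sigma|\Gamma,p\Rightarrow p,\Delta$ and $\Sigma|\bot,\Gamma\Rightarrow\Delta$; logical rules (with $\Sigma$ unchanged): $(R\wedge)$ $\Sigma|\Gamma\Rightarrow\Delta,A_1$ and $\Sigma|\Gamma\Rightarrow\Delta,A_2$ / $\Sigma|\Gamma\Rightarrow\Delta,A_1\wedge A_2$; $(L\wedge)$ $\Sigma|A_1,A_2,\Gamma\Rightarrow\Delta$ / $\Sigma|A_1\wedge A_2,\Gamma\Rightarrow\Delta$; $(R\vee)$ $\Sigma|\Gamma\Rightarrow\Delta,A_1,A_2$ / $\Sigma|\Gamma\Rightarrow\Delta,A_1\vee A_2$; $(L\vee)$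 $\Sigma|A_1,\Gamma\Rightarrow\Delta$ and $\Sigma|A_2,\Gamma\Rightarrow\Delta$ / $\Sigma|A_1\vee A_2,\Gamma\Rightarrow\Delta$; $(R\rightarrow)$ $\Sigma|A_1,\Gamma\Rightarrow\Delta,A_2$ / $\Sigma|\Gamma\Rightarrow\Delta,A_1\rightarrow A_2$; $(L\rightarrow)$ $\Sigma|\Gamma\Rightarrow\Delta,A_1$ and $\Sigma|A_2,\Gamma\Rightarrow\Delta$ / $\Sigma|A_1\rightarrow A_2,\Gamma\Rightarrow\Delta$; $(R\neg)$ $\Sigma|A,\Gamma\Rightarrow\Delta$ / $\Sigma|\Gamma\Rightarrow\Delta,\neg A$; $(L\neg)$ $\Sigma|\Gamma\Rightarrow\Delta,A$ / $\Sigma|\neg A,\Gamma\Rightarrow\Delta$. Modal rules: $(\Box^+_{Kn})$: from $\emptyset|\Gamma\Rightarrow A$ infer $\Sigma,\Box_i\Gamma|\Pi\Rightarrow\Box_iA,\Omega$, where $\Sigma$ contains only formulas $\Box_jB$ with $j\neq i$, $\Pi$ only propositional variables and $\bot$, $\Omega$ only propositional variables, $\bot$, or outmost-boxed formulas; $(\Box^+_{Tn})$: from $\Box_iA,\Sigma|\Gamma,A\Rightarrow\Delta$ infer $\Sigma|\Gamma,\Box_iA\Rightarrow\Delta$. -}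

module Defs where

open import Data.Nat using (ℕ; suc; _⊔_)
open import Data.Fin using (Fin; _≟_)
open import Data.List using (List; []; _∷_; _++_; map; [_])
open import Data.List.Relation.Unary.All using (All)
open import Data.List.Relation.Binary.Permutation.Propositional using (_↭_)
open import Data.Product using (_×_; _,_)
open import Data.Empty using (⊥)
open import Data.Unit using (⊤)
open import Relation.Binary.PropositionalEquality using (_≢_)

data Fm (m : ℕ) : Set where
  var  : ℕ → Fm m
  bot  : Fm m
  _∧_  : Fm m → Fm m → Fm m
  _∨_  : Fm m → Fm m → Fm m
  _⇒_  : Fm m → Fm m → Fm m
  ¬_   : Fm m → Fm m
  □    : Fin m → Fm m → Fm m

-- An outmost-boxed formula □_j B is represented by the pair (j , B).
Boxed : ℕ → Set
Boxed m = Fin m × Fm m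

□s : ∀ {m} → Fin m → List (Fm m) → List (Boxed m)
□s i Γ = map (λ A → (i , A)) Γ

-- T-sequent  Σ | Γ ⇒ Δ  ; multisets are lists taken up to permutation (see _≅_)
infix 4 _∣_⊢_
record TSeq (m : ℕ) : Set where
  constructor _∣_⊢_
  field
    sig : List (Boxed m)
    ant : List (Fm m)
    suc' : List (Fm m)

_≅_ : ∀ {m} → TSeq m → TSeq m → Set
(S ∣ G ⊢ D) ≅ (S' ∣ G' ⊢ D') = (S ↭ S') × (G ↭ G') × (D ↭ D')

AtomOrBot : ∀ {m} → Fm m → Set
AtomOrBot (var _) = ⊤
AtomOrBot bot     = ⊤
AtomOrBot _       = ⊥

AtomBotOrBoxed : ∀ {m} → Fm m → Set
AtomBotOrBoxed (var _) = ⊤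
AtomBotOrBoxed bot     = ⊤
AtomBotOrBoxed (□ _ _) = ⊤
AtomBotOrBoxed _       = ⊥

OtherAgent : ∀ {m} → Fin m → Boxed m → Set
OtherAgent i (j , _) = j ≢ i

-- Derivations in G(KT⁺_n). Each rule's conclusion is any sequent equal
-- (as multisets) to the displayed one.
data Deriv {m : ℕ} : TSeq m → Set where
  ax    : ∀ {s Σ Γ Δ p} → s ≅ (Σ ∣ var p ∷ Γ ⊢ var p ∷ Δ) → Deriv s
  axbot : ∀ {s Σ Γ Δ} → s ≅ (Σ ∣ bot ∷ Γ ⊢ Δ) → Deriv s
  R∧ : ∀ {s Σ Γ Δ A₁ A₂} → s ≅ (Σ ∣ Γ ⊢ (A₁ ∧ A₂) ∷ Δ) →
       Deriv (Σ ∣ Γ ⊢ A₁ ∷ Δ) → Deriv (Σ ∣ Γ ⊢ A₂ ∷ Δ) → Deriv s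
  L∧ : ∀ {s Σ Γ Δ A₁ A₂} → s ≅ (Σ ∣ (A₁ ∧ A₂) ∷ Γ ⊢ Δ) →
       Deriv (Σ ∣ A₁ ∷ A₂ ∷ Γ ⊢ Δ) → Deriv s
  R∨ : ∀ {s Σ Γ Δ A₁ A₂} → s ≅ (Σ ∣ Γ ⊢ (A₁ ∨ A₂) ∷ Δ) →
       Deriv (Σ ∣ Γ ⊢ A₁ ∷ A₂ ∷ Δ) → Deriv s
  L∨ : ∀ {s Σ Γ Δ A₁ A₂} → s ≅ (Σ ∣ (A₁ ∨ A₂) ∷ Γ ⊢ Δ) →
       Deriv (Σ ∣ A₁ ∷ Γ ⊢ Δ) → Deriv (Σ ∣ A₂ ∷ Γ ⊢ Δ) → Deriv s
  R⇒ : ∀ {s Σ Γ Δ A₁ A₂} → s ≅ (Σ ∣ Γ ⊢ (A₁ ⇒ A₂) ∷ Δ) →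
       Deriv (Σ ∣ A₁ ∷ Γ ⊢ A₂ ∷ Δ) → Deriv s
  L⇒ : ∀ {s Σ Γ Δ A₁ A₂} → s ≅ (Σ ∣ (A₁ ⇒ A₂) ∷ Γ ⊢ Δ) →
       Deriv (Σ ∣ Γ ⊢ A₁ ∷ Δ) → Deriv (Σ ∣ A₂ ∷ Γ ⊢ Δ) → Deriv s
  R¬ : ∀ {s Σ Γ Δ A} → s ≅ (Σ ∣ Γ ⊢ (¬ A) ∷ Δ) →
       Deriv (Σ ∣ A ∷ Γ ⊢ Δ) → Deriv s
  L¬ : ∀ {s Σ Γ Δ A} → s ≅ (Σ ∣ (¬ A) ∷ Γ ⊢ Δ) →
       Deriv (Σ ∣ Γ ⊢ A ∷ Δ) → Deriv s
  boxK : ∀ {s} (i : Fin m) {Σ Γ Π Ω A} →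
         All (OtherAgent i) Σ → All AtomOrBot Π → All AtomBotOrBoxed Ω →
         s ≅ ((Σ ++ □s i Γ) ∣ Π ⊢ □ i A ∷ Ω) →
         Deriv ([] ∣ Γ ⊢ [ A ]) → Deriv s
  boxT : ∀ {s} (i : Fin m) {Σ Γ Δ A} → s ≅ (Σ ∣ □ i A ∷ Γ ⊢ Δ) →
         Deriv ((i , A) ∷ Σ ∣ A ∷ Γ ⊢ Δ) → Deriv s

height : ∀ {m} {s : TSeq m} → Deriv s → ℕ
height (ax _)          = 0
height (axbot _)       = 0
height (R∧ _ d e)      = suc (height d ⊔ height e)
height (L∧ _ d)        = suc (height d)
height (R∨ _ d)        = suc (height d)
height (L∨ _ d e)      = suc (height d ⊔ height e)
height (R⇒ _ d)        = suc (height d)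
height (L⇒ _ d e)      = suc (height d ⊔ height e)
height (R¬ _ d)        = suc (height d)
height (L¬ _ d)        = suc (height d)
height (boxK _ _ _ _ _ d) = suc (height d)
height (boxT _ _ d)    = suc (height d)

{-# OPTIONS --safe #-}
-- Every rule except (□⁺_Kn) leaves the box-context Σ
-- unchanged and accepts an arbitrary one, so □ᵢ A can be added to it throughout;
-- when □ᵢ A is a side formula the inversion is pushed into the premises, and when it
-- is principal (an instance of (□⁺_Tn)) the premise is already the inverted sequent.
-- (□⁺_Kn) never applies, since its antecedent Π holds only atoms and ⊥.
module Submission where

open import Defs
open import Data.Nat using (ℕ; _≤_; s≤s; z≤n)
open import Data.Nat.Properties using (≤-trans; ⊔-mono-≤; n≤1+n)
open import Data.Fin using (Fin)
open import Data.List using (List; []; _∷_; _++_; [_])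
open import Data.List.Membership.Propositional.Properties using (∈-∃++)
open import Data.List.Relation.Binary.Permutation.Propositional
open import Data.List.Relation.Binary.Permutation.Propositional.Properties
  using (∈-resp-↭; shift; drop-∷; ++⁺ˡ)
open import Data.List.Relation.Unary.All using (lookup)
open import Data.List.Relation.Unary.Any using (here; there)
open import Data.Product using (Σ-syntax; ∃-syntax; _×_; _,_)
open import Data.Sum using (_⊎_; inj₁; inj₂)
open import Data.Empty using (⊥-elim)
open import Relation.Binary.PropositionalEquality using (_≡_; refl; sym; subst)

private
  variable
    m n : ℕ
    X : Set
    x y : X
    xs ys zs : List X

∷↭∷-inv : x ∷ xs ↭ y ∷ ys → (x ≡ y × xs ↭ ys) ⊎ ∃[ zs ] (xs ↭ y ∷ zs × ys ↭ x ∷ zs)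
∷↭∷-inv {x = x} {y = y} {ys = ys} p with ∈-resp-↭ (↭-sym p) (here refl)
... | here refl = inj₁ (refl , drop-∷ p)
... | there y∈xs with ∈-∃++ y∈xs
...   | as , bs , refl = inj₂ (as ++ bs , shift y as bs , drop-∷ y∷ys↭y∷x∷as++bs)
  where
  y∷ys↭y∷x∷as++bs : y ∷ ys ↭ y ∷ x ∷ as ++ bs
  y∷ys↭y∷x∷as++bs = ↭-trans (↭-sym p) (↭-trans (prep x (shift y as bs)) (swap x y ↭-refl))

↭-under : ∀ pre → xs ↭ y ∷ ys → pre ++ xs ↭ y ∷ pre ++ ys
↭-under {y = y} {ys = ys} pre p = ↭-trans (++⁺ˡ pre p) (shift y pre ys)

≅-refl : {s : TSeq m} → s ≅ s
≅-refl = ↭-refl , ↭-refl , ↭-refl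

≅-trans : {s t u : TSeq m} → s ≅ t → t ≅ u → s ≅ u
≅-trans (σ , γ , δ) (σ' , γ' , δ') = ↭-trans σ σ' , ↭-trans γ γ' , ↭-trans δ δ'

Deriv≤ : ℕ → TSeq m → Set
Deriv≤ n s = Σ[ d ∈ Deriv s ] height d ≤ n

exchange : {s t : TSeq m} → Deriv s → t ≅ s → Deriv t
exchange (ax p)              q = ax (≅-trans q p)
exchange (axbot p)           q = axbot (≅-trans q p)
exchange (R∧ p d e)          q = R∧ (≅-trans q p) d e
exchange (L∧ p d)            q = L∧ (≅-trans q p) d
exchange (R∨ p d)            q = R∨ (≅-trans q p) d
exchange (L∨ p d e)          q = L∨ (≅-trans q p) d e
exchange (R⇒ p d)            q = R⇒ (≅-trans q p) d
exchange (L⇒ p d e)          q = L⇒ (≅-trans q p) d e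
exchange (R¬ p d)            q = R¬ (≅-trans q p) d
exchange (L¬ p d)            q = L¬ (≅-trans q p) d
exchange (boxK i a b c p d)  q = boxK i a b c (≅-trans q p) d
exchange (boxT i p d)        q = boxT i (≅-trans q p) d

height-exchange : {s t : TSeq m} (d : Deriv s) (q : t ≅ s) → height (exchange d q) ≡ height d
height-exchange (ax _)               _ = refl
height-exchange (axbot _)            _ = refl
height-exchange (R∧ _ _ _)           _ = refl
height-exchange (L∧ _ _)             _ = refl
height-exchange (R∨ _ _)             _ = refl
height-exchange (L∨ _ _ _)           _ = refl
height-exchange (R⇒ _ _)             _ = refl
height-exchange (L⇒ _ _ _)           _ = refl
height-exchange (R¬ _ _)             _ = refl
height-exchange (L¬ _ _)             _ = refl
height-exchange (boxK _ _ _ _ _ _)   _ = refl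
height-exchange (boxT _ _ _)         _ = refl

exchange≤ : {s t : TSeq m} → Deriv≤ n s → t ≅ s → Deriv≤ n t
exchange≤ (d , h) q = exchange d q , subst (_≤ _) (sym (height-exchange d q)) h

module _ (i : Fin m) (A : Fm m) where

  invert-conclusionᴸ : ∀ {S G D Σ' Y Γ' Δ'} → (S ∣ □ i A ∷ G ⊢ D) ≅ (Σ' ∣ Y ∷ Γ' ⊢ Δ') →
    (Y ≡ □ i A × ((i , A) ∷ S ∣ A ∷ G ⊢ D) ≅ ((i , A) ∷ Σ' ∣ A ∷ Γ' ⊢ Δ'))
    ⊎ ∃[ zs ] (Γ' ↭ □ i A ∷ zs × ((i , A) ∷ S ∣ A ∷ G ⊢ D) ≅ ((i , A) ∷ Σ' ∣ Y ∷ A ∷ zs ⊢ Δ'))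
  invert-conclusionᴸ (σ , γ , δ) with ∷↭∷-inv γ
  ... | inj₁ (refl , G↭Γ') = inj₁ (refl , prep _ σ , prep A G↭Γ' , δ)
  ... | inj₂ (zs , G↭Y∷zs , Γ'↭□A∷zs) = inj₂ (zs , Γ'↭□A∷zs , prep _ σ , ↭-under [ _ ] G↭Y∷zs , δ)

  invert-conclusionᴿ : ∀ {S G D Σ' Γ' Δ'} → (S ∣ □ i A ∷ G ⊢ D) ≅ (Σ' ∣ Γ' ⊢ Δ') →
    Γ' ↭ □ i A ∷ G × ((i , A) ∷ S ∣ A ∷ G ⊢ D) ≅ ((i , A) ∷ Σ' ∣ A ∷ G ⊢ Δ')
  invert-conclusionᴿ (σ , γ , δ) = ↭-sym γ , prep _ σ , ↭-refl , δ

  mutual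
    invert : ∀ {s S G D} (d : Deriv s) → (S ∣ □ i A ∷ G ⊢ D) ≅ s →
             Deriv≤ (height d) ((i , A) ∷ S ∣ A ∷ G ⊢ D)
    invert (ax r) q with invert-conclusionᴸ (≅-trans q r)
    ... | inj₁ (() , _)
    ... | inj₂ (_ , _ , c) = ax c , z≤n
    invert (axbot r) q with invert-conclusionᴸ (≅-trans q r)
    ... | inj₁ (() , _)
    ... | inj₂ (_ , _ , c) = axbot c , z≤n
    invert (L∧ r d) q with invert-conclusionᴸ (≅-trans q r)
    ... | inj₁ (() , _)
    ... | inj₂ (_ , g , c) with invert-premise (_ ∷ [ _ ]) d g
    ...   | e , h = L∧ c e , s≤s h
    invert (L∨ r d₁ d₂) q with invert-conclusionᴸ (≅-trans q r)
    ... | inj₁ (() , _)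
    ... | inj₂ (_ , g , c) with invert-premise [ _ ] d₁ g | invert-premise [ _ ] d₂ g
    ...   | e₁ , h₁ | e₂ , h₂ = L∨ c e₁ e₂ , s≤s (⊔-mono-≤ h₁ h₂)
    invert (L⇒ r d₁ d₂) q with invert-conclusionᴸ (≅-trans q r)
    ... | inj₁ (() , _)
    ... | inj₂ (_ , g , c) with invert-premise [] d₁ g | invert-premise [ _ ] d₂ g
    ...   | e₁ , h₁ | e₂ , h₂ = L⇒ c e₁ e₂ , s≤s (⊔-mono-≤ h₁ h₂)
    invert (L¬ r d) q with invert-conclusionᴸ (≅-trans q r)
    ... | inj₁ (() , _)
    ... | inj₂ (_ , g , c) with invert-premise [] d g
    ...   | e , h = L¬ c e , s≤s h
    invert (boxT j r d) q with invert-conclusionᴸ (≅-trans q r)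
    ... | inj₁ (refl , c) = exchange≤ (d , n≤1+n _) c
    ... | inj₂ (_ , g , c) with exchange≤ (invert-premise [ _ ] d g) (swap _ _ ↭-refl , ↭-refl , ↭-refl)
    ...   | e , h = boxT j c e , s≤s h
    invert (R∧ r d₁ d₂) q with invert-conclusionᴿ (≅-trans q r)
    ... | g , c with invert-premise [] d₁ g | invert-premise [] d₂ g
    ...   | e₁ , h₁ | e₂ , h₂ = R∧ c e₁ e₂ , s≤s (⊔-mono-≤ h₁ h₂)
    invert (R∨ r d) q with invert-conclusionᴿ (≅-trans q r)
    ... | g , c with invert-premise [] d g
    ...   | e , h = R∨ c e , s≤s h
    invert (R⇒ r d) q with invert-conclusionᴿ (≅-trans q r)
    ... | g , c with invert-premise [ _ ] d g
    ...   | e , h = R⇒ c e , s≤s h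
    invert (R¬ r d) q with invert-conclusionᴿ (≅-trans q r)
    ... | g , c with invert-premise [ _ ] d g
    ...   | e , h = R¬ c e , s≤s h
    invert (boxK _ _ atomic _ r _) q with ≅-trans q r
    ... | _ , γ , _ = ⊥-elim (lookup atomic (∈-resp-↭ γ (here refl)))

    invert-premise : ∀ pre {S Γ D zs} (d : Deriv (S ∣ pre ++ Γ ⊢ D)) → Γ ↭ □ i A ∷ zs →
                     Deriv≤ (height d) ((i , A) ∷ S ∣ pre ++ A ∷ zs ⊢ D)
    invert-premise pre {zs = zs} d g =
      exchange≤ (invert d (↭-refl , ↭-sym (↭-under pre g) , ↭-refl)) (↭-refl , shift A pre zs , ↭-refl)

proposition4p9 : ∀ {m : ℕ} (i : Fin m) (A : Fm m) (S : List (Boxed m)) (Γ Δ : List (Fm m)) (n : ℕ)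
    → (d : Deriv (S ∣ □ i A ∷ Γ ⊢ Δ)) → height d ≤ n
    → Σ[ d' ∈ Deriv ((i , A) ∷ S ∣ A ∷ Γ ⊢ Δ) ] height d' ≤ n
proposition4p9 i A S Γ Δ n d h with invert i A d ≅-refl
... | d' , h' = d' , ≤-trans h' h
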